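{- Let either $s\geq 6$ and $m=5$, or $s=5$ and $m=35$. Let $f:(\mathbb{Z}/m)^{\times(2)}\to[0,1]$ be a function with $\mathbb{E}[f]>D_s$. Then for every $y\in\mathbb{Z}/m$ there exist $x_1,\dots,x_s\in(\mathbb{Z}/m)^{\times(2)}$ with $y=x_1+\dots+x_s$ such that \[ \frac{1}{s}\big(f(x_1)+\dots+f(x_s)\big)>d_s\quad\text{and}\quad f(x_j)\neq0\text{ for all }1\leq j\leq s. \]
   Context: $(\mathbb{Z}/m)^{\times(2)}=\{x\in\mathbb{Z}/m: x=y^2 \text{ for some } y\in(\mathbb{Z}/m)^\times\}$; $\mathbb{E}[f]$ is the average of $f$ over its domain. For integers $s\geq5$: $D_s=59/60$ if $s=5$; $7/8$ if $s=6$; $3/4$ if $s=7$; $(s+13)/(4s)$ if $8\leq s\leq 12$; $1/2$ if $s\geq 13$. And $d_s=9/10$ if $s=5$; $5/6$ if $s=6$; $(s+13)/(4s)$ if $7\leq s\leq 12$; $1/2$ if $s\geq 13$.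
   Formalization: The function f takes only rational values in [0,1]. -}

module Defs where

open import Data.Bool using (Bool; true; false; T; _∧_; _∨_; if_then_else_)
open import Data.Bool.Properties using (T?)
open import Data.Nat using (ℕ; zero; suc; _+_; _*_; _≡ᵇ_; _≤ᵇ_; NonZero)
open import Data.Nat.DivMod using (_%_)
open import Data.Nat.GCD using (gcd)
open import Data.Fin using (Fin; toℕ)
open import Data.List using (List; []; _∷_; foldr; map; length; allFin)
open import Data.Product using (Σ; _,_; proj₁)
open import Data.Integer using (+_)
open import Data.Rational using (ℚ; _/_) renaming (_+_ to _+ℚ_; _*_ to _*ℚ_)
import Data.Rational as Q
open import Relation.Nullary using (yes; no)

-- ℤ/m is modelled by Fin m (residues 0 … m-1).

isUnitSquare : (m : ℕ) .{{_ : NonZero m}} → Fin m → Bool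
isUnitSquare m x =
  foldr _∨_ false
    (map (λ y → (gcd (toℕ y) m ≡ᵇ 1) ∧ (((toℕ y * toℕ y) % m) ≡ᵇ toℕ x)) (allFin m))

USq : (m : ℕ) .{{_ : NonZero m}} → Set
USq m = Σ (Fin m) (λ x → T (isUnitSquare m x))

filterUSq : (m : ℕ) .{{_ : NonZero m}} → List (Fin m) → List (USq m)
filterUSq m [] = []
filterUSq m (x ∷ xs) with T? (isUnitSquare m x)
... | yes p = (x , p) ∷ filterUSq m xs
... | no _  = filterUSq m xs

allUSq : (m : ℕ) .{{_ : NonZero m}} → List (USq m)
allUSq m = filterUSq m (allFin m)

sumℚ : List ℚ → ℚ
sumℚ = foldr _+ℚ_ Q.0ℚ

-- arithmetic mean of a list of rationals (mean of [] is 0, never used)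
mean : List ℚ → ℚ
mean [] = Q.0ℚ
mean (q ∷ qs) = sumℚ (q ∷ qs) *ℚ ((+ 1) / length (q ∷ qs))

expect : (m : ℕ) .{{_ : NonZero m}} → (USq m → ℚ) → ℚ
expect m f = mean (map f (allUSq m))

sumMod : (m : ℕ) .{{_ : NonZero m}} (s : ℕ) → (Fin s → USq m) → ℕ
sumMod m s xs = foldr _+_ 0 (map (λ i → toℕ (proj₁ (xs i))) (allFin s)) % m

mid : ℕ → ℚ
mid zero = Q.0ℚ
mid (suc k) = (+ (suc k + 13)) / (4 * suc k)

D : ℕ → ℚ
D s = if s ≡ᵇ 5 then (+ 59) / 60
      else if s ≡ᵇ 6 then (+ 7) / 8
      else if s ≡ᵇ 7 then (+ 3) / 4
      else if s ≤ᵇ 12 then mid s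
      else (+ 1) / 2

d : ℕ → ℚ
d s = if s ≡ᵇ 5 then (+ 9) / 10
      else if s ≡ᵇ 6 then (+ 5) / 6
      else if s ≤ᵇ 12 then mid s
      else (+ 1) / 2

module Submission where

-- For m = 5 the unit squares are 1 and 4. Call them a and b so that q = f a ≤ p = f b; the
-- hypothesis on 𝔼[f] says q + p > 2 D_s. Use t copies of a followed by s − t copies of b,
-- with 0 ≤ t ≤ 4. Since a − b is a unit mod 5, some such t gives the sum t·a + (s − t)·b ≡ y.
-- For every such t the f-sum t q + (s − t) p is at least 4q + (s − 4)p, and this exceeds
-- s d_s: for s ≥ 8 because p > D_s = d_s, and for s = 6, 7 because p ≤ 1 gives
-- 4q + (s − 4)p ≥ 4(q + p) − (8 − s) > 8 D_s − (8 − s) = s d_s. Moreover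
-- q > 2 D_s − 1 ≥ 0, so no value is 0.
--
-- For m = 35 there are six unit squares. Their f-values are at most 1 and sum to more than
-- 6 · 59/60, so each one exceeds 6 · 59/60 − 5 = 9/10 = d_5. Hence any way of writing y as a
-- sum of five unit squares works, and an exhaustive search finds one for every y.

open import Defs
open import Data.Nat using (ℕ; _≤_; NonZero)
open import Data.Fin using (Fin; toℕ)
open import Data.List using (map; allFin)
open import Data.Product using (Σ; _×_; proj₁)
open import Data.Sum using (_⊎_)
open import Data.Rational using (ℚ; 0ℚ; 1ℚ; _<_) renaming (_≤_ to _≤ℚ_)
open import Relation.Binary.PropositionalEquality using (_≡_; _≢_)

open import Algebra.Bundles using (Monoid; CommutativeMonoid; Ring)
open import Data.Bool using (T)
open import Data.Bool.Properties using (T?; T-irrelevant)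
open import Data.Nat using (zero; suc; _+_; _*_; _∸_; z≤n; s≤s)
import Data.Nat as ℕ
open import Algebra.Definitions.RawMonoid ℕ.+-0-rawMonoid using () renaming (_×_ to _×ℕ_)
import Data.Nat.Properties as NP
open import Data.Nat.DivMod using (_%_; [m+kn]%n≡m%n)
import Data.Nat.Coprimality as Coprime
open import Data.Nat.Solver using (module +-*-Solver)
open import Data.Fin using (#_; _≟_)
open import Data.Fin.Properties using (all?; any?; toℕ≤pred[n])
import Data.Integer as ℤ
import Data.Integer.Properties as ℤP
open import Data.Rational using (mkℚ; _/_; 1/_; _<?_) renaming (_+_ to _+ℚ_; _*_ to _*ℚ_)
import Data.Rational as Q
import Data.Rational.Properties as QP
open import Data.List using (List; []; _∷_; [_]; length; foldr; tabulate; cartesianProductWith)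
import Data.List.Properties as LP
open import Data.List.Membership.Propositional using (_∈_)
open import Data.List.Membership.Propositional.Properties using (∈-allFin; ∈-map⁺)
open import Data.List.Relation.Unary.All as All using (All; []; _∷_)
import Data.List.Relation.Unary.All.Properties as Allₚ
open import Data.List.Relation.Unary.Any as Any using (Any; here; there)
open import Data.Vec using (Vec; lookup) renaming ([] to []ᵥ; _∷_ to _∷ᵥ_)
open import Data.Product using (Σ-syntax; _,_; proj₂)
open import Data.Sum using (inj₁; inj₂; [_,_]′)
open import Function using (id; _∘_; _⇔_; mk⇔; Equivalence)
open import Relation.Binary.PropositionalEquality
  using (refl; sym; trans; cong; cong₂; subst; subst₂; ≢-sym; module ≡-Reasoning)
open import Relation.Nullary using (yes; no; ¬?; contradiction)
open import Relation.Nullary.Decidable using (toWitness; _→-dec_)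

blocks : ∀ {a} {A : Set a} {s} → ℕ → A → A → Fin s → A
blocks zero    x y _           = y
blocks (suc t) x y Fin.zero    = x
blocks (suc t) x y (Fin.suc j) = blocks t x y j

blocks-preserves : ∀ {a p} {A : Set a} (P : A → Set p) {x y} → P x → P y →
  ∀ {s} t (j : Fin s) → P (blocks t x y j)
blocks-preserves P px py zero    j           = py
blocks-preserves P px py (suc t) Fin.zero    = px
blocks-preserves P px py (suc t) (Fin.suc j) = blocks-preserves P px py t j

module _ {c ℓ} (M : Monoid c ℓ) where
  open Monoid M renaming (refl to ≈-refl; trans to ≈-trans)
  open import Algebra.Properties.Monoid.Mult M using () renaming (_×_ to _·_)
  open import Relation.Binary.Reasoning.Setoid setoid

  sum-const : ∀ s x → foldr _∙_ ε (tabulate {n = s} (λ _ → x)) ≈ s · x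
  sum-const zero    x = ≈-refl
  sum-const (suc s) x = ∙-congˡ (sum-const s x)

  sum-blocks : ∀ {a} {A : Set a} (g : A → Carrier) (x y : A) {s} t → t ≤ s →
    foldr _∙_ ε (map (g ∘ blocks t x y) (allFin s)) ≈ t · g x ∙ (s ∸ t) · g y
  sum-blocks g x y {s} t t≤s =
    ≈-trans (reflexive (cong (foldr _∙_ ε) (LP.map-tabulate {n = s} id (g ∘ blocks t x y))))
            (sum-tabulate t t≤s)
    where
    sum-tabulate : ∀ {s} t → t ≤ s →
      foldr _∙_ ε (tabulate {n = s} (g ∘ blocks t x y)) ≈ t · g x ∙ (s ∸ t) · g y
    sum-tabulate {s} zero z≤n = begin
      foldr _∙_ ε (tabulate {n = s} (λ _ → g y)) ≈⟨ sum-const s (g y) ⟩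
      s · g y                                    ≈⟨ identityˡ _ ⟨
      ε ∙ s · g y                                ∎
    sum-tabulate (suc t) (s≤s {n = s} t≤s) = begin
      g x ∙ foldr _∙_ ε (tabulate {n = s} (g ∘ blocks t x y)) ≈⟨ ∙-congˡ (sum-tabulate t t≤s) ⟩
      g x ∙ (t · g x ∙ (s ∸ t) · g y)                        ≈⟨ assoc _ _ _ ⟨
      (g x ∙ t · g x) ∙ (s ∸ t) · g y                        ∎

open import Algebra.Properties.CommutativeMonoid.Mult QP.+-0-commutativeMonoid
  using (×-homo-+; ×-distrib-+; ×-assocˡ) renaming (_×_ to _·_)
open import Algebra.Properties.Semiring.Mult (Ring.semiring QP.+-*-ring)
  using (×-assoc-*; ×-comm-*)

·-mono-≤ : ∀ n {x y} → x ≤ℚ y → n · x ≤ℚ n · y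
·-mono-≤ zero    _   = QP.≤-refl
·-mono-≤ (suc n) x≤y = QP.+-mono-≤ x≤y (·-mono-≤ n x≤y)

·-mono-< : ∀ n {x y} → x < y → suc n · x < suc n · y
·-mono-< n x<y = QP.+-mono-<-≤ x<y (·-mono-≤ n (QP.<⇒≤ x<y))

·-cancel-< : ∀ n {x y} → n · x < n · y → x < y
·-cancel-< n {x} {y} nx<ny with x <? y
... | yes x<y = x<y
... | no  x≮y = contradiction (QP.<-≤-trans nx<ny (·-mono-≤ n (QP.≮⇒≥ x≮y))) (QP.<-irrefl refl)

+-cancelʳ-< : ∀ {x y} r → x +ℚ r < y +ℚ r → x < y
+-cancelʳ-< {x} {y} r x+r<y+r = subst₂ _<_ (cancel x) (cancel y) (QP.+-monoˡ-< (Q.- r) x+r<y+r)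
  where
  cancel : ∀ z → z +ℚ r +ℚ Q.- r ≡ z
  cancel z = trans (QP.+-assoc z r (Q.- r)) (trans (cong (z +ℚ_) (QP.+-inverseʳ r)) (QP.+-identityʳ z))

[_/1] : ℕ → ℚ
[ n /1] = mkℚ (ℤ.+ n) 0 (Coprime.sym (Coprime.1-coprimeTo n))

/1≡[/1] : ∀ n → ℤ.+ n / 1 ≡ [ n /1]
/1≡[/1] n = QP.normalize-coprime (Coprime.sym (Coprime.1-coprimeTo n))

·1≡/1 : ∀ n → n · 1ℚ ≡ ℤ.+ n / 1
·1≡/1 zero    = refl
·1≡/1 (suc n) = begin
  1ℚ +ℚ n · 1ℚ   ≡⟨ cong (1ℚ +ℚ_) (trans (·1≡/1 n) (/1≡[/1] n)) ⟩
  1ℚ +ℚ [ n /1]  ≡⟨ cong (λ i → (ℤ.+ 1 ℤ.+ i) / 1) (ℤP.*-identityʳ (ℤ.+ n)) ⟩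
  ℤ.+ suc n / 1  ∎
  where open ≡-Reasoning

·1/n≡1 : ∀ n .{{_ : NonZero n}} → n · (ℤ.+ 1 / n) ≡ 1ℚ
·1/n≡1 n@(suc _) = begin
  n · (ℤ.+ 1 / n)          ≡⟨ cong (n ·_) (QP.*-identityˡ (ℤ.+ 1 / n)) ⟨
  n · (1ℚ *ℚ (ℤ.+ 1 / n))  ≡⟨ ×-assoc-* n 1ℚ (ℤ.+ 1 / n) ⟨
  n · 1ℚ *ℚ (ℤ.+ 1 / n)    ≡⟨ cong₂ _*ℚ_ (trans (·1≡/1 n) (/1≡[/1] n)) 1/n≡1/[n/1] ⟩
  [ n /1] *ℚ 1/ [ n /1]    ≡⟨ QP.*-inverseʳ [ n /1] ⟩
  1ℚ                       ∎
  where
  open ≡-Reasoning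
  1/n≡1/[n/1] : ℤ.+ 1 / n ≡ 1/ [ n /1]
  1/n≡1/[n/1] = QP.normalize-coprime (Coprime.1-coprimeTo n)

·-*-1/n : ∀ n .{{_ : NonZero n}} x → n · (x *ℚ (ℤ.+ 1 / n)) ≡ x
·-*-1/n n x = begin
  n · (x *ℚ (ℤ.+ 1 / n))  ≡⟨ ×-comm-* n x (ℤ.+ 1 / n) ⟨
  x *ℚ n · (ℤ.+ 1 / n)    ≡⟨ cong (x *ℚ_) (·1/n≡1 n) ⟩
  x *ℚ 1ℚ                 ≡⟨ QP.*-identityʳ x ⟩
  x                       ∎
  where open ≡-Reasoning

<-mean⇔ : ∀ {n x} (qs : List ℚ) → length qs ≡ suc n → x < mean qs ⇔ suc n · x < sumℚ qs
<-mean⇔ {n} {x} qs@(_ ∷ _) refl = mk⇔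
  (λ x<mean → subst (suc n · x <_) (·-*-1/n (suc n) (sumℚ qs)) (·-mono-< n x<mean))
  (λ nx<sum → ·-cancel-< (suc n) (subst (suc n · x <_) (sym (·-*-1/n (suc n) (sumℚ qs))) nx<sum))

sum-< : ∀ {x q} qs → All (x <_) (q ∷ qs) → length (q ∷ qs) · x < sumℚ (q ∷ qs)
sum-< []       (x<q ∷ []) = QP.+-mono-<-≤ x<q QP.≤-refl
sum-< (_ ∷ qs) (x<q ∷ xs) = QP.+-mono-< x<q (sum-< qs xs)

<-mean : ∀ {x} q qs → All (x <_) (q ∷ qs) → x < mean (q ∷ qs)
<-mean q qs x<qs = Equivalence.from (<-mean⇔ (q ∷ qs) refl) (sum-< qs x<qs)

sum-≤ : ∀ {c} qs → All (_≤ℚ c) qs → sumℚ qs ≤ℚ length qs · c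
sum-≤ []       []          = QP.≤-refl
sum-≤ (_ ∷ qs) (q≤c ∷ qs≤c) = QP.+-mono-≤ q≤c (sum-≤ qs qs≤c)

sum-≤-∈ : ∀ {c q} qs → All (_≤ℚ c) qs → q ∈ qs → sumℚ qs ≤ℚ q +ℚ (length qs ∸ 1) · c
sum-≤-∈ (q ∷ qs) (_ ∷ qs≤c) (here refl) = QP.+-monoʳ-≤ q (sum-≤ qs qs≤c)
sum-≤-∈ {c} {q} (r ∷ qs@(_ ∷ qs′)) (r≤c ∷ qs≤c) (there q∈qs) = begin
  r +ℚ sumℚ qs                     ≤⟨ QP.+-mono-≤ r≤c (sum-≤-∈ qs qs≤c q∈qs) ⟩
  c +ℚ (q +ℚ length qs′ · c)       ≡⟨ x∙yz≈y∙xz c q _ ⟩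
  q +ℚ (c +ℚ length qs′ · c)       ∎
  where
  open QP.≤-Reasoning
  open import Algebra.Properties.CommutativeSemigroup
    (CommutativeMonoid.commutativeSemigroup QP.+-0-commutativeMonoid) using (x∙yz≈y∙xz)

·-exchange : ∀ {q p} k n {t} → q ≤ℚ p → t ≤ k → k · q +ℚ n · p ≤ℚ t · q +ℚ (k + n ∸ t) · p
·-exchange {q} {p} k n {t} q≤p t≤k = begin
  k · q +ℚ n · p                        ≡⟨ cong (λ i → i · q +ℚ n · p) (NP.m+[n∸m]≡n t≤k) ⟨
  (t + (k ∸ t)) · q +ℚ n · p            ≡⟨ cong (_+ℚ n · p) (×-homo-+ q t (k ∸ t)) ⟩
  t · q +ℚ (k ∸ t) · q +ℚ n · p         ≤⟨ QP.+-monoˡ-≤ (n · p) (QP.+-monoʳ-≤ (t · q) (·-mono-≤ (k ∸ t) q≤p)) ⟩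
  t · q +ℚ (k ∸ t) · p +ℚ n · p         ≡⟨ QP.+-assoc (t · q) _ _ ⟩
  t · q +ℚ ((k ∸ t) · p +ℚ n · p)       ≡⟨ cong (t · q +ℚ_) (×-homo-+ p (k ∸ t) n) ⟨
  t · q +ℚ (k ∸ t + n) · p              ≡⟨ cong (λ i → t · q +ℚ i · p) (NP.+-∸-comm n t≤k) ⟨
  t · q +ℚ (k + n ∸ t) · p              ∎
  where open QP.≤-Reasoning

2·D<q+p⇒D<p : ∀ {D q p} → q ≤ℚ p → 2 · D < q +ℚ p → D < p
2·D<q+p⇒D<p {D} {q} {p} q≤p 2D<q+p = ·-cancel-< 2 (begin-strict
  2 · D          <⟨ 2D<q+p ⟩
  q +ℚ p         ≤⟨ QP.+-monoˡ-≤ p q≤p ⟩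
  p +ℚ p         ≡⟨ cong (p +ℚ_) (QP.+-identityʳ p) ⟨
  2 · p          ∎)
  where open QP.≤-Reasoning

four-q-bound-via-D≤p : ∀ w {D q p} → D ≤ℚ p → 2 · D < q +ℚ p → (8 + w) · D < 4 · q +ℚ (4 + w) · p
four-q-bound-via-D≤p w {D} {q} {p} D≤p 2D<q+p = begin-strict
  (8 + w) · D               ≡⟨ ×-homo-+ D 8 w ⟩
  8 · D +ℚ w · D            ≡⟨ cong (_+ℚ w · D) (×-assocˡ D 4 2) ⟨
  4 · (2 · D) +ℚ w · D      <⟨ QP.+-mono-<-≤ (·-mono-< 3 2D<q+p) (·-mono-≤ w D≤p) ⟩
  4 · (q +ℚ p) +ℚ w · p     ≡⟨ cong (_+ℚ w · p) (×-distrib-+ q p 4) ⟩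
  4 · q +ℚ 4 · p +ℚ w · p   ≡⟨ QP.+-assoc (4 · q) _ _ ⟩
  4 · q +ℚ (4 · p +ℚ w · p) ≡⟨ cong (4 · q +ℚ_) (×-homo-+ p 4 w) ⟨
  4 · q +ℚ (4 + w) · p      ∎
  where open QP.≤-Reasoning

four-q-bound-via-p≤1 : ∀ w z {D q p} → w + z ≡ 4 → p ≤ℚ 1ℚ → 2 · D < q +ℚ p →
  4 · (2 · D) < 4 · q +ℚ w · p +ℚ z · 1ℚ
four-q-bound-via-p≤1 w z {D} {q} {p} w+z≡4 p≤1 2D<q+p = begin-strict
  4 · (2 · D)                  <⟨ ·-mono-< 3 2D<q+p ⟩
  4 · (q +ℚ p)                 ≡⟨ ×-distrib-+ q p 4 ⟩
  4 · q +ℚ 4 · p               ≡⟨ cong (λ k → 4 · q +ℚ k · p) w+z≡4 ⟨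
  4 · q +ℚ (w + z) · p         ≡⟨ cong (4 · q +ℚ_) (×-homo-+ p w z) ⟩
  4 · q +ℚ (w · p +ℚ z · p)    ≤⟨ QP.+-monoʳ-≤ (4 · q) (QP.+-monoʳ-≤ (w · p) (·-mono-≤ z p≤1)) ⟩
  4 · q +ℚ (w · p +ℚ z · 1ℚ)   ≡⟨ QP.+-assoc (4 · q) _ _ ⟨
  4 · q +ℚ w · p +ℚ z · 1ℚ     ∎
  where open QP.≤-Reasoning

four-q-bound : ∀ n {q p} → q ≤ℚ p → p ≤ℚ 1ℚ → 2 · D (6 + n) < q +ℚ p →
  (6 + n) · d (6 + n) < 4 · q +ℚ (2 + n) · p
four-q-bound 0 {q} {p} _ p≤1 2D<q+p =
  +-cancelʳ-< {6 · d 6} {4 · q +ℚ 2 · p} (2 · 1ℚ) (four-q-bound-via-p≤1 2 2 {D 6} {q} {p} refl p≤1 2D<q+p)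
four-q-bound 1 {q} {p} _ p≤1 2D<q+p =
  +-cancelʳ-< {7 · d 7} {4 · q +ℚ 3 · p} (1 · 1ℚ) (four-q-bound-via-p≤1 3 1 {D 7} {q} {p} refl p≤1 2D<q+p)
four-q-bound (suc (suc w)) {q} {p} q≤p _ 2D<q+p =
  four-q-bound-via-D≤p w {D (8 + w)} {q} {p} (QP.<⇒≤ (2·D<q+p⇒D<p q≤p 2D<q+p)) 2D<q+p

1≤2·D : ∀ n → 1ℚ ≤ℚ 2 · D (6 + n)
1≤2·D 0 = QP.≤ᵇ⇒≤ _
1≤2·D 1 = QP.≤ᵇ⇒≤ _
1≤2·D 2 = QP.≤ᵇ⇒≤ _
1≤2·D 3 = QP.≤ᵇ⇒≤ _
1≤2·D 4 = QP.≤ᵇ⇒≤ _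
1≤2·D 5 = QP.≤ᵇ⇒≤ _
1≤2·D 6 = QP.≤ᵇ⇒≤ _
1≤2·D (suc (suc (suc (suc (suc (suc (suc _))))))) = QP.≤ᵇ⇒≤ _

1<q+p⇒0<q : ∀ {q p} → p ≤ℚ 1ℚ → 1ℚ < q +ℚ p → 0ℚ < q
1<q+p⇒0<q {q} {p} p≤1 1<q+p = +-cancelʳ-< 1ℚ (begin-strict
  0ℚ +ℚ 1ℚ  ≡⟨ QP.+-identityˡ 1ℚ ⟩
  1ℚ        <⟨ 1<q+p ⟩
  q +ℚ p    ≤⟨ QP.+-monoʳ-≤ q p≤1 ⟩
  q +ℚ 1ℚ   ∎)
  where open QP.≤-Reasoning

0<⇒≢0 : ∀ {x} → 0ℚ < x → x ≢ 0ℚ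
0<⇒≢0 0<x = ≢-sym (QP.<⇒≢ 0<x)

-- Results of exhaustive searches are opaque so that no caller unfolds the search.
opaque
  two-point-residues-n<5 : ∀ (a b : Fin 5) → a ≢ b → ∀ (r y : Fin 5) →
    Σ[ t ∈ Fin 5 ] toℕ y ≡ (toℕ t * toℕ a + (4 + toℕ r ∸ toℕ t) * toℕ b) % 5
  two-point-residues-n<5 = toWitness {a? = all? λ a → all? λ b → ¬? (a ≟ b) →-dec
    all? λ r → all? λ y → any? λ t → toℕ y ℕ.≟ (toℕ t * toℕ a + (4 + toℕ r ∸ toℕ t) * toℕ b) % 5} _

two-point-residues : ∀ {a b : Fin 5} → a ≢ b → ∀ n (y : Fin 5) →
  Σ[ t ∈ Fin 5 ] toℕ y ≡ (toℕ t * toℕ a + (4 + n ∸ toℕ t) * toℕ b) % 5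
two-point-residues a≢b 0 = two-point-residues-n<5 _ _ a≢b (# 0)
two-point-residues a≢b 1 = two-point-residues-n<5 _ _ a≢b (# 1)
two-point-residues a≢b 2 = two-point-residues-n<5 _ _ a≢b (# 2)
two-point-residues a≢b 3 = two-point-residues-n<5 _ _ a≢b (# 3)
two-point-residues a≢b 4 = two-point-residues-n<5 _ _ a≢b (# 4)
two-point-residues {a} {b} a≢b (suc (suc (suc (suc (suc n))))) y
  with t , y≡ ← two-point-residues a≢b n y = t , trans y≡ (sym five-more-b)
  where
  open ≡-Reasoning
  open +-*-Solver
  ta k : ℕ
  ta = toℕ t * toℕ a
  k  = 4 + n ∸ toℕ t
  five-more-b : (ta + (9 + n ∸ toℕ t) * toℕ b) % 5 ≡ (ta + k * toℕ b) % 5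
  five-more-b = begin
    (ta + (5 + (4 + n) ∸ toℕ t) * toℕ b) % 5 ≡⟨ cong (λ i → (ta + i * toℕ b) % 5) (NP.+-∸-assoc 5 t≤4+n) ⟩
    (ta + (5 + k) * toℕ b) % 5              ≡⟨ cong (_% 5) (solve 3 (λ x y z →
                                                   x :+ (con 5 :+ y) :* z := (x :+ y :* z) :+ z :* con 5)
                                                 refl ta k (toℕ b)) ⟩
    (ta + k * toℕ b + toℕ b * 5) % 5        ≡⟨ [m+kn]%n≡m%n (ta + k * toℕ b) (toℕ b) 5 ⟩
    (ta + k * toℕ b) % 5                    ∎
    where
    t≤4+n : toℕ t ≤ 4 + n
    t≤4+n = NP.≤-trans (toℕ≤pred[n] t) (NP.m≤m+n 4 n)

×ℕ≡* : ∀ n x → n ×ℕ x ≡ n * x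
×ℕ≡* zero    x = refl
×ℕ≡* (suc n) x = cong (x +_) (×ℕ≡* n x)

value : ∀ {m} .{{_ : NonZero m}} → USq m → ℕ
value = toℕ ∘ proj₁

sumMod-blocks : ∀ {m} .{{_ : NonZero m}} (x y : USq m) s t → t ≤ s →
  sumMod m s (blocks t x y) ≡ (t * value x + (s ∸ t) * value y) % m
sumMod-blocks {m} x y s t t≤s = cong (_% m) (begin
  foldr _+_ 0 (map (value ∘ blocks t x y) (allFin s)) ≡⟨ sum-blocks NP.+-0-monoid value x y t t≤s ⟩
  t ×ℕ value x + (s ∸ t) ×ℕ value y              ≡⟨ cong₂ _+_ (×ℕ≡* t (value x)) (×ℕ≡* (s ∸ t) (value y)) ⟩
  t * value x + (s ∸ t) * value y                ∎)
  where open ≡-Reasoning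

∈-filterUSq : ∀ {m} .{{_ : NonZero m}} {x xs} (p : T (isUnitSquare m x)) → x ∈ xs → (x , p) ∈ filterUSq m xs
∈-filterUSq {m} {x} p (here refl) with T? (isUnitSquare m x)
... | yes p′ = here (cong (x ,_) (T-irrelevant p p′))
... | no ¬p  = contradiction p ¬p
∈-filterUSq {m} {xs = x′ ∷ _} p (there x∈xs) with T? (isUnitSquare m x′)
... | yes _ = there (∈-filterUSq p x∈xs)
... | no  _ = ∈-filterUSq p x∈xs

∈-allUSq : ∀ {m} .{{_ : NonZero m}} (x : USq m) → x ∈ allUSq m
∈-allUSq (x , p) = ∈-filterUSq p (∈-allFin x)

vectors : ∀ {a} {A : Set a} k → List A → List (Vec A k)
vectors zero    xs = [ []ᵥ ]
vectors (suc k) xs = cartesianProductWith _∷ᵥ_ xs (vectors k xs)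

opaque
  sum-of-five-unit-squares-mod-35 : ∀ (y : Fin 35) →
    Any (λ xs → toℕ y ≡ sumMod 35 5 (lookup xs)) (vectors 5 (allUSq 35))
  sum-of-five-unit-squares-mod-35 = toWitness {a? = all? λ y →
    Any.any? (λ xs → toℕ y ℕ.≟ sumMod 35 5 (lookup xs)) (vectors 5 (allUSq 35))} _

Representation : (m s : ℕ) .{{_ : NonZero m}} → (USq m → ℚ) → Fin m → Set
Representation m s f y = Σ (Fin s → USq m) λ xs →
  (toℕ y ≡ sumMod m s xs) ×
  (d s < mean (map (λ j → f (xs j)) (allFin s))) ×
  (∀ j → f (xs j) ≢ 0ℚ)

u₁ u₄ : USq 5
u₁ = # 1 , _
u₄ = # 4 , _

two-block-representation : ∀ n (f : USq 5 → ℚ) → (∀ x → f x ≤ℚ 1ℚ) → ∀ a b → proj₁ a ≢ proj₁ b →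
  f a ≤ℚ f b → 2 · D (6 + n) < f a +ℚ f b → ∀ y → Representation 5 (6 + n) f y
two-block-representation n f f≤1 a b a≢b fa≤fb 2D<fa+fb y = blocks (toℕ t) a b , y≡Σ , d<mean , ≢0
  where
  s : ℕ
  s = 6 + n
  t : Fin 5
  t = proj₁ (two-point-residues a≢b (2 + n) y)
  t≤4 : toℕ t ≤ 4
  t≤4 = toℕ≤pred[n] t
  t≤s : toℕ t ≤ s
  t≤s = NP.≤-trans t≤4 (NP.m≤m+n 4 (2 + n))
  y≡Σ : toℕ y ≡ sumMod 5 s (blocks (toℕ t) a b)
  y≡Σ = trans (proj₂ (two-point-residues a≢b (2 + n) y)) (sym (sumMod-blocks a b s (toℕ t) t≤s))
  fxs : List ℚ
  fxs = map (f ∘ blocks (toℕ t) a b) (allFin s)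
  length-fxs : length fxs ≡ s
  length-fxs = trans (LP.length-map _ (allFin s)) (LP.length-tabulate id)
  d<mean : d s < mean fxs
  d<mean = Equivalence.from (<-mean⇔ {5 + n} fxs length-fxs) (begin-strict
    s · d s                            <⟨ four-q-bound n fa≤fb (f≤1 b) 2D<fa+fb ⟩
    4 · f a +ℚ (2 + n) · f b           ≤⟨ ·-exchange 4 (2 + n) fa≤fb t≤4 ⟩
    toℕ t · f a +ℚ (s ∸ toℕ t) · f b   ≡⟨ sum-blocks QP.+-0-monoid f a b (toℕ t) t≤s ⟨
    sumℚ fxs                           ∎)
    where open QP.≤-Reasoning
  0<fa : 0ℚ < f a
  0<fa = 1<q+p⇒0<q (f≤1 b) (QP.≤-<-trans (1≤2·D n) 2D<fa+fb)
  ≢0 : ∀ j → f (blocks (toℕ t) a b j) ≢ 0ℚ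
  ≢0 = blocks-preserves (λ x → f x ≢ 0ℚ) (0<⇒≢0 0<fa) (0<⇒≢0 (QP.<-≤-trans 0<fa fa≤fb)) (toℕ t)

representation-mod-5 : ∀ n (f : USq 5 → ℚ) → (∀ x → f x ≤ℚ 1ℚ) → D (6 + n) < expect 5 f →
  ∀ y → Representation 5 (6 + n) f y
representation-mod-5 n f f≤1 D<𝔼f =
  [ (λ f₁≤f₄ → two-block-representation n f f≤1 u₁ u₄ (λ ()) f₁≤f₄ 2D<f₁+f₄)
  , (λ f₄≤f₁ → two-block-representation n f f≤1 u₄ u₁ (λ ()) f₄≤f₁ 2D<f₄+f₁)
  ]′ (QP.≤-total (f u₁) (f u₄))
  where
  2D<f₁+f₄ : 2 · D (6 + n) < f u₁ +ℚ f u₄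
  2D<f₁+f₄ = subst (2 · D (6 + n) <_) (cong (f u₁ +ℚ_) (QP.+-identityʳ (f u₄)))
    (Equivalence.to (<-mean⇔ (map f (allUSq 5)) refl) D<𝔼f)
  2D<f₄+f₁ : 2 · D (6 + n) < f u₄ +ℚ f u₁
  2D<f₄+f₁ = subst (2 · D (6 + n) <_) (QP.+-comm (f u₁) (f u₄)) 2D<f₁+f₄

d₅<f : ∀ (f : USq 35 → ℚ) → (∀ x → f x ≤ℚ 1ℚ) → D 5 < expect 35 f → ∀ x → d 5 < f x
d₅<f f f≤1 D<𝔼f x = +-cancelʳ-< (5 · 1ℚ) (begin-strict
  d 5 +ℚ 5 · 1ℚ                ≡⟨⟩
  6 · D 5                      <⟨ Equivalence.to (<-mean⇔ (map f (allUSq 35)) refl) D<𝔼f ⟩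
  sumℚ (map f (allUSq 35))     ≤⟨ sum-≤-∈ _ (Allₚ.map⁺ (All.universal f≤1 _)) (∈-map⁺ f (∈-allUSq x)) ⟩
  f x +ℚ 5 · 1ℚ                ∎)
  where open QP.≤-Reasoning

representation-mod-35 : ∀ (f : USq 35 → ℚ) → (∀ x → f x ≤ℚ 1ℚ) → D 5 < expect 35 f →
  ∀ y → Representation 35 5 f y
representation-mod-35 f f≤1 D<𝔼f y with xs , y≡Σ ← Any.satisfied (sum-of-five-unit-squares-mod-35 y) =
  lookup xs , y≡Σ , d<mean , λ j → 0<⇒≢0 (QP.<-trans 0<d₅ (large (lookup xs j)))
  where
  large : ∀ x → d 5 < f x
  large = d₅<f f f≤1 D<𝔼f
  0<d₅ : 0ℚ < d 5
  0<d₅ = QP.positive⁻¹ (d 5)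
  d<mean : d 5 < mean (map (f ∘ lookup xs) (allFin 5))
  d<mean = <-mean _ _ (Allₚ.map⁺ (All.universal (large ∘ lookup xs) (allFin 5)))

proposition8p1 : (s m : ℕ) .{{_ : NonZero m}} →
    ((6 ≤ s × m ≡ 5) ⊎ (s ≡ 5 × m ≡ 35)) →
    (f : USq m → ℚ) →
    (∀ x → 0ℚ ≤ℚ f x × f x ≤ℚ 1ℚ) →
    D s < expect m f →
    (y : Fin m) →
    Σ (Fin s → USq m) (λ xs →
      (toℕ y ≡ sumMod m s xs) ×
      (d s < mean (map (λ j → f (xs j)) (allFin s))) ×
      (∀ j → f (xs j) ≢ 0ℚ))
proposition8p1 _ _ (inj₁ (s≤s (s≤s (s≤s (s≤s (s≤s (s≤s z≤n))))) , refl)) f f∈[0,1] =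
  representation-mod-5 _ f (proj₂ ∘ f∈[0,1])
proposition8p1 _ _ (inj₂ (refl , refl)) f f∈[0,1] = representation-mod-35 f (proj₂ ∘ f∈[0,1])
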